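{- Let $\mathcal{F}$ be an unsatisfiable CNF formula and let $\mathcal{R}_{\mathcal{F}}$ be its rotation graph. Then starting from any vertex of $\mathcal{R}_{\mathcal{F}}$ (i.e. any complete assignment to the variables of $\mathcal{F}$), there exists a directed path in $\mathcal{R}_{\mathcal{F}}$ that visits an assoc for every clause $c \in \mathcal{F}$ such that $A(c,\mathcal{F}) \neq \emptyset$.
   Context: A literal is a Boolean variable $x$ or its negation $\lnot x$, with $\lnot\lnot l = l$. A clause is a non-empty set of literals (a disjunction); a CNF formula $\mathcal{F}$ is a set of clauses (a conjunction). An assignment is a set of literals $a$ such that $l \in a$ implies $\lnot l \notin a$. The assignment $a$ satisfies a clause $c$ if $a \cap c \neq \emptyset$, and satisfies a formula if it satisfies all of its clauses. A complete assignment to the variables of $\mathcal{F}$ is an assignment containing, for each variable $x$ occurring in $\mathcal{F}$, exactly one of $x, \lnot x$ (and no other literals). An associated assignment (assoc) for a clause $c \in \mathcal{F}$ is a complete assignment that satisfies $\mathcal{F} \setminus \{c\}$ and does not satisfy $c$. The set of all assocs for $c$ is denoted $A(c,\mathcal{F})$. For an assignment $a$ and a literal $l$, define $\mathrm{flip}(a,l) = (a \setminus \{l\}) \cup \{\lnot l\}$. For an assignment $a$, $\mathrm{Unsat}(\mathcal{F},a) = \{ c \in \mathcal{F} \mid c \cap a = \emptyset\}$, and $\bigcup \mathrm{Unsat}(\mathcal{F},a)$ is the set of all literals occurring in these clauses. The rotation graph $\mathcal{R}_{\mathcal{F}} = (V_R,E_R)$ of an unsatisfiable formula $\mathcal{F}$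 is the directed graph whose vertices are the complete assignments to the variables of $\mathcal{F}$, with an edge $(a,a') \in E_R$ whenever $a' = \mathrm{flip}(a,\lnot l)$ for some literal $l \in \bigcup \mathrm{Unsat}(\mathcal{F},a)$. -}

module Defs where

open import Data.Nat using (ℕ)
import Data.Nat.Properties as ℕP
open import Data.List using (List; []; _∷_; _++_; filter; [_])
open import Data.List.Membership.Propositional using (_∈_; _∉_)
open import Data.List.Relation.Unary.All using (All)
open import Data.List.Relation.Unary.Linked using (Linked)
open import Data.Product using (Σ; ∃; _×_; _,_)
open import Data.Sum using (_⊎_)
open import Data.Empty using (⊥)
open import Relation.Nullary using (¬_; Dec; yes; no)
open import Relation.Nullary.Decidable using (¬?)
open import Relation.Binary.PropositionalEquality using (_≡_; _≢_; refl; cong)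
open import Function.Bundles using (_⇔_)

data Literal : Set where
  pos : ℕ → Literal
  neg : ℕ → Literal

negate : Literal → Literal
negate (pos x) = neg x
negate (neg x) = pos x

var : Literal → ℕ
var (pos x) = x
var (neg x) = x

_≟L_ : (l m : Literal) → Dec (l ≡ m)
pos x ≟L pos y with x ℕP.≟ y
... | yes refl = yes refl
... | no x≢y = no λ { refl → x≢y refl }
pos x ≟L neg y = no λ ()
neg x ≟L pos y = no λ ()
neg x ≟L neg y with x ℕP.≟ y
... | yes refl = yes refl
... | no x≢y = no λ { refl → x≢y refl }

-- Clauses, formulas and assignments are finite SETS, represented by lists
-- and compared extensionally (by membership).
Clause : Set
Clause = List Literal

Formula : Set
Formula = List Clause

Assignment : Set
Assignment = List Literal

_≈_ : {A : Set} → List A → List A → Set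
xs ≈ ys = ∀ z → (z ∈ xs) ⇔ (z ∈ ys)

NonEmpty : Clause → Set
NonEmpty c = ∃ λ l → l ∈ c

WellFormed : Formula → Set
WellFormed F = All NonEmpty F

IsAssignment : Assignment → Set
IsAssignment a = ∀ l → l ∈ a → negate l ∉ a

SatClause : Assignment → Clause → Set
SatClause a c = ∃ λ l → l ∈ a × l ∈ c

Satisfies : Assignment → Formula → Set
Satisfies a F = ∀ c → c ∈ F → SatClause a c

Unsatisfiable : Formula → Set
Unsatisfiable F = ¬ (Σ Assignment λ a → IsAssignment a × Satisfies a F)

Occurs : ℕ → Formula → Set
Occurs x F = ∃ λ c → c ∈ F × (pos x ∈ c ⊎ neg x ∈ c)

IsComplete : Formula → Assignment → Set
IsComplete F a =
  IsAssignment a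
  × (∀ x → Occurs x F → pos x ∈ a ⊎ neg x ∈ a)
  × (∀ l → l ∈ a → Occurs (var l) F)

SatisfiesExcept : Assignment → Formula → Clause → Set
SatisfiesExcept a F c = ∀ c' → c' ∈ F → ¬ (c' ≈ c) → SatClause a c'

IsAssoc : Formula → Clause → Assignment → Set
IsAssoc F c a = IsComplete F a × SatisfiesExcept a F c × ¬ SatClause a c

HasAssoc : Formula → Clause → Set
HasAssoc F c = ∃ λ a → IsAssoc F c a

flip : Assignment → Literal → Assignment
flip a l = filter (λ m → ¬? (m ≟L l)) a ++ [ negate l ]

InUnsatLits : Formula → Assignment → Literal → Set
InUnsatLits F a l = ∃ λ c → c ∈ F × (∀ m → m ∈ c → m ∉ a) × l ∈ c

RotEdge : Formula → Assignment → Assignment → Set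
RotEdge F a a' =
  IsComplete F a × IsComplete F a'
  × ∃ λ l → InUnsatLits F a l × (a' ≈ flip a (negate l))

IsPathFrom : Formula → Assignment → List Assignment → Set
IsPathFrom F a vs = ∃ λ rest → vs ≡ a ∷ rest × All (IsComplete F) vs × Linked (RotEdge F) vs

module Submission where

-- Fix a "target" set of literals t.  From a complete
-- assignment a, as long as some clause falsified by a contains a literal
-- l ∈ t with ¬l ∉ t, the rotation graph has the edge a → flip(a, ¬l), which
-- makes l true and keeps every literal of t already true under a.  Hence the
-- number of literals of t missing from the current assignment strictly
-- decreases, and the walk ends in a vertex y that is "settled" for t: no
-- clause falsified by y contains such a literal.  If t is (as a set) an assoc
-- b of a clause c, then a settled y satisfies every clause other than c
-- (each of them contains a literal of b), and since F is unsatisfiable y must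
-- falsify c; so y is itself an assoc of c.

open import Defs
open import Data.List using (List; []; _∷_; _++_; filter; [_]; map)
open import Data.List.Membership.Propositional using (_∈_; _∉_; find; lose)
open import Data.List.Membership.Propositional.Properties
  using (∈-++⁺ˡ; ∈-++⁺ʳ; ∈-++⁻; ∈-map⁺; ∈-map⁻; ∈-filter⁺; ∈-filter⁻)
open import Data.List.Membership.DecPropositional _≟L_ using (_∈?_)
open import Data.List.Relation.Unary.Any using (Any; here; there; any?)
open import Data.List.Relation.Unary.All as All using (All; []; _∷_; all?)
open import Data.List.Relation.Unary.All.Properties using (¬All⇒Any¬)
open import Data.List.Relation.Unary.Linked using (Linked; [-]; _∷_)
open import Data.Product using (Σ; ∃; _×_; _,_; proj₁; proj₂)
open import Data.Sum using (_⊎_; inj₁; inj₂; swap)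
open import Data.Empty using (⊥-elim)
open import Data.Nat using (ℕ; suc; _≤_; _<_; s≤s; z≤n)
open import Data.Nat.Properties using (m≤n⇒m≤1+n; m<n⇒m<1+n)
open import Data.Nat.Induction using (<-wellFounded)
open import Induction.WellFounded using (Acc; acc)
open import Relation.Nullary using (¬_; Dec; yes; no)
open import Relation.Nullary.Decidable using (¬?; _×-dec_)
open import Relation.Binary.PropositionalEquality
  using (_≡_; _≢_; refl; sym; trans; cong; subst)
open import Function.Bundles using (mk⇔; Equivalence)

negate-involutive : ∀ l → negate (negate l) ≡ l
negate-involutive (pos x) = refl
negate-involutive (neg x) = refl

negate-injective : ∀ {l m} → negate l ≡ negate m → l ≡ m
negate-injective {pos x} {pos .x} refl = refl
negate-injective {neg x} {neg .x} refl = refl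

negate-≢ : ∀ l → negate l ≢ l
negate-≢ (pos x) ()
negate-≢ (neg x) ()

var-negate : ∀ l → var (negate l) ≡ var l
var-negate (pos x) = refl
var-negate (neg x) = refl

literal-occurs : ∀ {F c l} → c ∈ F → l ∈ c → Occurs (var l) F
literal-occurs {c = c} {pos x} c∈F l∈c = c , c∈F , inj₁ l∈c
literal-occurs {c = c} {neg x} c∈F l∈c = c , c∈F , inj₂ l∈c

∈-flip⁻ : ∀ {a k m} → m ∈ flip a k → (m ∈ a × m ≢ k) ⊎ m ≡ negate k
∈-flip⁻ {a} {k} m∈ with ∈-++⁻ (filter (λ m → ¬? (m ≟L k)) a) m∈
... | inj₁ m∈a∖k = inj₁ (∈-filter⁻ (λ m → ¬? (m ≟L k)) m∈a∖k)
... | inj₂ (here m≡¬k) = inj₂ m≡¬k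

∈-flip-kept : ∀ {a k m} → m ∈ a → m ≢ k → m ∈ flip a k
∈-flip-kept {a} {k} m∈a m≢k = ∈-++⁺ˡ (∈-filter⁺ (λ m → ¬? (m ≟L k)) m∈a m≢k)

∈-flip-new : ∀ {a k} → negate k ∈ flip a k
∈-flip-new {a} {k} = ∈-++⁺ʳ (filter (λ m → ¬? (m ≟L k)) a) (here refl)

∈-flip-kept-or-negated : ∀ {a k m} → m ∈ a → m ∈ flip a k ⊎ negate m ∈ flip a k
∈-flip-kept-or-negated {a} {k} {m} m∈a with m ≟L k
... | yes refl = inj₂ (∈-flip-new {a} {k})
... | no m≢k = inj₁ (∈-flip-kept m∈a m≢k)

flip-assignment : ∀ {a} k → IsAssignment a → IsAssignment (flip a k)
flip-assignment {a} k isA m m∈ ¬m∈ with ∈-flip⁻ {a} {k} m∈ | ∈-flip⁻ {a} {k} ¬m∈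
... | inj₁ (m∈a , _) | inj₁ (¬m∈a , _) = isA m m∈a ¬m∈a
... | inj₁ (_ , m≢k) | inj₂ ¬m≡¬k = m≢k (negate-injective ¬m≡¬k)
... | inj₂ m≡¬k | inj₁ (_ , ¬m≢k) =
  ¬m≢k (trans (cong negate m≡¬k) (negate-involutive k))
... | inj₂ m≡¬k | inj₂ ¬m≡¬k = negate-≢ k (trans (sym m≡¬k) (negate-injective ¬m≡¬k))

flip-complete : ∀ {F a} k → Occurs (var k) F → IsComplete F a → IsComplete F (flip a k)
flip-complete {F} {a} k k-occurs (isA , covers , occurs) =
  flip-assignment k isA , covers′ , occurs′
  where
  covers′ : ∀ x → Occurs x F → pos x ∈ flip a k ⊎ neg x ∈ flip a k
  covers′ x x-occurs with covers x x-occurs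
  ... | inj₁ x∈a = ∈-flip-kept-or-negated x∈a
  ... | inj₂ ¬x∈a = swap (∈-flip-kept-or-negated ¬x∈a)

  occurs′ : ∀ m → m ∈ flip a k → Occurs (var m) F
  occurs′ m m∈ with ∈-flip⁻ {a} {k} m∈
  ... | inj₁ (m∈a , _) = occurs m m∈a
  ... | inj₂ refl = subst (λ x → Occurs x F) (sym (var-negate k)) k-occurs

≈-refl : ∀ {A : Set} {xs : List A} → xs ≈ xs
≈-refl _ = mk⇔ (λ z∈ → z∈) (λ z∈ → z∈)

satClause? : ∀ a c → Dec (SatClause a c)
satClause? a c with any? (_∈? a) c
... | yes some = let l , l∈c , l∈a = find some in yes (l , l∈a , l∈c)
... | no none = no λ (l , l∈a , l∈c) → none (lose l∈c l∈a)

falsified-clause : ∀ {F a} → Unsatisfiable F → IsAssignment a →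
  ∃ λ c → c ∈ F × ¬ SatClause a c
falsified-clause {F} {a} unsat isA with all? (satClause? a) F
... | yes all-sat = ⊥-elim (unsat (a , isA , λ c c∈F → All.lookup all-sat c∈F))
... | no ¬all-sat = find (¬All⇒Any¬ (satClause? a) F ¬all-sat)

missing : List Literal → Assignment → ℕ
missing [] a = 0
missing (m ∷ t) a with m ∈? a
... | yes _ = missing t a
... | no _ = suc (missing t a)

missing-mono : ∀ t {a a'} → (∀ m → m ∈ t → m ∈ a → m ∈ a') → missing t a' ≤ missing t a
missing-mono [] keeps = z≤n
missing-mono (m ∷ t) {a} {a'} keeps with m ∈? a' | m ∈? a
... | yes _ | yes _ = missing-mono t (λ n n∈t → keeps n (there n∈t))
... | yes _ | no _ = m≤n⇒m≤1+n (missing-mono t (λ n n∈t → keeps n (there n∈t)))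
... | no m∉a' | yes m∈a = ⊥-elim (m∉a' (keeps m (here refl) m∈a))
... | no _ | no _ = s≤s (missing-mono t (λ n n∈t → keeps n (there n∈t)))

missing-strict : ∀ t {a a' l} → (∀ m → m ∈ t → m ∈ a → m ∈ a') →
  l ∈ t → l ∉ a → l ∈ a' → missing t a' < missing t a
missing-strict (m ∷ t) {a} {a'} keeps (here refl) l∉a l∈a' with m ∈? a' | m ∈? a
... | _ | yes l∈a = ⊥-elim (l∉a l∈a)
... | no l∉a' | no _ = ⊥-elim (l∉a' l∈a')
... | yes _ | no _ = s≤s (missing-mono t (λ n n∈t → keeps n (there n∈t)))
missing-strict (m ∷ t) {a} {a'} keeps (there l∈t) l∉a l∈a' with m ∈? a' | m ∈? a
... | yes _ | yes _ = missing-strict t (λ n n∈t → keeps n (there n∈t)) l∈t l∉a l∈a'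
... | yes _ | no _ = m<n⇒m<1+n (missing-strict t (λ n n∈t → keeps n (there n∈t)) l∈t l∉a l∈a')
... | no m∉a' | yes m∈a = ⊥-elim (m∉a' (keeps m (here refl) m∈a))
... | no _ | no _ = s≤s (missing-strict t (λ n n∈t → keeps n (there n∈t)) l∈t l∉a l∈a')

-- Clause c pulls a towards the target t: c is falsified by a and contains a
-- literal l ∈ t with ¬l ∉ t, so making l true cannot lose a literal of t.
Pulls : List Literal → Assignment → Clause → Set
Pulls t a c = All (_∉ a) c × Any (λ l → l ∈ t × negate l ∉ t) c

Pulls? : ∀ t a c → Dec (Pulls t a c)
Pulls? t a c = all? (λ m → ¬? (m ∈? a)) c ×-dec any? (λ l → (l ∈? t) ×-dec ¬? (negate l ∈? t)) c

module RotationWalks (F : Formula) where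

  Settled : List Literal → Assignment → Set
  Settled t a = ¬ Any (Pulls t a) F

  record Progress (t : List Literal) (a : Assignment) : Set where
    field
      next : Assignment
      edge : RotEdge F a next
      closer : missing t next < missing t a

  rotate-at : ∀ {t a c l} → IsComplete F a → c ∈ F → All (_∉ a) c → l ∈ c →
    l ∈ t → negate l ∉ t → Progress t a
  rotate-at {t} {a} {c} {l} a-complete c∈F c-false l∈c l∈t ¬l∉t = record
    { next = a'
    ; edge = a-complete , a'-complete , l
           , (c , c∈F , (λ m → All.lookup c-false) , l∈c) , ≈-refl
    ; closer = missing-strict t keeps l∈t (All.lookup c-false l∈c) l∈a'
    }
    where
    a' = flip a (negate l)

    a'-complete : IsComplete F a'
    a'-complete = flip-complete (negate l)
      (subst (λ x → Occurs x F) (sym (var-negate l)) (literal-occurs c∈F l∈c)) a-complete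

    l∈a' : l ∈ a'
    l∈a' = subst (_∈ a') (negate-involutive l) (∈-flip-new {a} {negate l})

    keeps : ∀ m → m ∈ t → m ∈ a → m ∈ a'
    keeps m m∈t m∈a with m ≟L negate l
    ... | yes refl = ⊥-elim (¬l∉t m∈t)
    ... | no m≢¬l = ∈-flip-kept m∈a m≢¬l

  rotate-towards : ∀ {t a} → IsComplete F a → Any (Pulls t a) F → Progress t a
  rotate-towards a-complete pulls with find pulls
  ... | _ , c∈F , c-false , wanted with find wanted
  ... | _ , l∈c , l∈t , ¬l∉t = rotate-at a-complete c∈F c-false l∈c l∈t ¬l∉t

  data Walk : Assignment → Assignment → Set where
    stay : ∀ {a} → IsComplete F a → Walk a a
    step : ∀ {a b z} → RotEdge F a b → Walk b z → Walk a z

  later : ∀ {a z} → Walk a z → List Assignment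
  later (stay _) = []
  later (step {b = b} _ w) = b ∷ later w

  vertices : ∀ {a z} → Walk a z → List Assignment
  vertices {a} w = a ∷ later w

  vertices-linked : ∀ {a z} (w : Walk a z) → Linked (RotEdge F) (vertices w)
  vertices-linked (stay _) = [-]
  vertices-linked (step e w) = e ∷ vertices-linked w

  vertices-complete : ∀ {a z} (w : Walk a z) → All (IsComplete F) (vertices w)
  vertices-complete (stay a-complete) = a-complete ∷ []
  vertices-complete (step e w) = proj₁ e ∷ vertices-complete w

  end-complete : ∀ {a z} → Walk a z → IsComplete F z
  end-complete (stay z-complete) = z-complete
  end-complete (step _ w) = end-complete w

  end∈vertices : ∀ {a z} (w : Walk a z) → z ∈ vertices w
  end∈vertices (stay _) = here refl
  end∈vertices (step _ w) = there (end∈vertices w)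

  _++ʷ_ : ∀ {a b z} → Walk a b → Walk b z → Walk a z
  stay _ ++ʷ w′ = w′
  step e w ++ʷ w′ = step e (w ++ʷ w′)

  ∈-++ʷ⁺ˡ : ∀ {a b z x} (w : Walk a b) (w′ : Walk b z) → x ∈ vertices w → x ∈ vertices (w ++ʷ w′)
  ∈-++ʷ⁺ˡ (stay _) w′ (here refl) = here refl
  ∈-++ʷ⁺ˡ (step _ w) w′ (here refl) = here refl
  ∈-++ʷ⁺ˡ (step _ w) w′ (there x∈) = there (∈-++ʷ⁺ˡ w w′ x∈)

  ∈-++ʷ⁺ʳ : ∀ {a b z x} (w : Walk a b) (w′ : Walk b z) → x ∈ vertices w′ → x ∈ vertices (w ++ʷ w′)
  ∈-++ʷ⁺ʳ (stay _) w′ x∈ = x∈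
  ∈-++ʷ⁺ʳ (step _ w) w′ x∈ = there (∈-++ʷ⁺ʳ w w′ x∈)

  walk-towards : ∀ t {a} → IsComplete F a → Acc _<_ (missing t a) →
    ∃ λ y → Walk a y × Settled t y
  walk-towards t {a} a-complete (acc smaller) with any? (Pulls? t a) F
  ... | no settled = a , stay a-complete , settled
  ... | yes pulls =
    let open Progress (rotate-towards a-complete pulls)
        y , w , y-settled = walk-towards t (proj₁ (proj₂ edge)) (smaller closer)
    in y , step edge w , y-settled

  tour : (ts : List (List Literal)) → ∀ {a} → IsComplete F a →
    ∃ λ z → Σ (Walk a z) λ w → All (λ t → ∃ λ y → y ∈ vertices w × Settled t y) ts
  tour [] {a} a-complete = a , stay a-complete , []
  tour (t ∷ ts) {a} a-complete with walk-towards t a-complete (<-wellFounded (missing t a))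
  ... | y , w , y-settled with tour ts (end-complete w)
  ... | z , w′ , visits =
    z , w ++ʷ w′ , (y , ∈-++ʷ⁺ˡ w w′ (end∈vertices w) , y-settled)
                 ∷ All.map (λ (x , x∈ , x-settled) → x , ∈-++ʷ⁺ʳ w w′ x∈ , x-settled) visits

open RotationWalks

-- A complete vertex settled for a target with the same elements as an assoc b
-- of c is itself an assoc of c: every other clause contains a literal of b,
-- which would pull the vertex if that clause were falsified; and since F is
-- unsatisfiable, only c remains to be falsified.
settled-assoc : ∀ {F c b t y} → Unsatisfiable F → IsAssoc F c b → t ≈ b →
  IsComplete F y → Settled F t y → IsAssoc F c y
settled-assoc {F} {c} {b} {t} {y} unsat (b-complete , b-others , _) t≈b y-complete y-settled =
  y-complete , y-others , y-falsifies-c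
  where
  y-others : SatisfiesExcept y F c
  y-others c′ c′∈F c′≉c with satClause? y c′
  ... | yes y-sat = y-sat
  ... | no y-unsat =
    let l , l∈b , l∈c′ = b-others c′ c′∈F c′≉c
        c′-false = All.tabulate (λ m∈c′ m∈y → y-unsat (_ , m∈y , m∈c′))
        l∈t = Equivalence.from (t≈b l) l∈b
        ¬l∉t = λ ¬l∈t → proj₁ b-complete l l∈b (Equivalence.to (t≈b _) ¬l∈t)
    in ⊥-elim (y-settled (lose c′∈F (c′-false , lose l∈c′ (l∈t , ¬l∉t))))

  y-falsifies-c : ¬ SatClause y c
  y-falsifies-c (l , l∈y , l∈c) =
    let c′ , c′∈F , y-unsat = falsified-clause unsat (proj₁ y-complete)
        c′≉c = λ c′≈c → y-unsat (l , l∈y , Equivalence.from (c′≈c l) l∈c)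
    in y-unsat (y-others c′ c′∈F c′≉c)

variables : Formula → List ℕ
variables [] = []
variables (c ∷ F) = map var c ++ variables F

occurs⇒∈variables : ∀ F {x} → Occurs x F → x ∈ variables F
occurs⇒∈variables (c ∷ F) (_ , here refl , inj₁ x∈c) = ∈-++⁺ˡ (∈-map⁺ var x∈c)
occurs⇒∈variables (c ∷ F) (_ , here refl , inj₂ ¬x∈c) = ∈-++⁺ˡ (∈-map⁺ var ¬x∈c)
occurs⇒∈variables (c ∷ F) (c′ , there c′∈F , x-in-c′) =
  ∈-++⁺ʳ (map var c) (occurs⇒∈variables F (c′ , c′∈F , x-in-c′))

∈variables⇒occurs : ∀ F {x} → x ∈ variables F → Occurs x F
∈variables⇒occurs (c ∷ F) x∈ with ∈-++⁻ (map var c) x∈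
... | inj₁ x∈c with ∈-map⁻ var x∈c
...   | l , l∈c , refl = literal-occurs (here refl) l∈c
∈variables⇒occurs (c ∷ F) x∈ | inj₂ x∈F =
  let c′ , c′∈F , x-in-c′ = ∈variables⇒occurs F x∈F in c′ , there c′∈F , x-in-c′

choices : List ℕ → List (List Literal)
choices [] = [ [] ]
choices (x ∷ xs) = map (pos x ∷_) (choices xs) ++ map (neg x ∷_) (choices xs)

restrict : Assignment → List ℕ → List Literal
restrict b [] = []
restrict b (x ∷ xs) with pos x ∈? b
... | yes _ = pos x ∷ restrict b xs
... | no _ = neg x ∷ restrict b xs

restrict-∈-choices : ∀ b xs → restrict b xs ∈ choices xs
restrict-∈-choices b [] = here refl
restrict-∈-choices b (x ∷ xs) with pos x ∈? b
... | yes _ = ∈-++⁺ˡ (∈-map⁺ (pos x ∷_) (restrict-∈-choices b xs))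
... | no _ = ∈-++⁺ʳ (map (pos x ∷_) (choices xs)) (∈-map⁺ (neg x ∷_) (restrict-∈-choices b xs))

restrict-⊆ : ∀ b xs {z} → (∀ x → x ∈ xs → pos x ∈ b ⊎ neg x ∈ b) → z ∈ restrict b xs → z ∈ b
restrict-⊆ b (x ∷ xs) assigns z∈ with pos x ∈? b | z∈
... | yes x∈b | here refl = x∈b
... | yes _ | there z∈′ = restrict-⊆ b xs (λ y y∈ → assigns y (there y∈)) z∈′
... | no x∉b | here refl with assigns x (here refl)
...   | inj₁ x∈b = ⊥-elim (x∉b x∈b)
...   | inj₂ ¬x∈b = ¬x∈b
restrict-⊆ b (x ∷ xs) assigns z∈ | no _ | there z∈′ =
  restrict-⊆ b xs (λ y y∈ → assigns y (there y∈)) z∈′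

⊆-restrict : ∀ b xs {z} → IsAssignment b → z ∈ b → var z ∈ xs → z ∈ restrict b xs
⊆-restrict b (x ∷ xs) {z} isA z∈b var∈ with pos x ∈? b | z | var∈
... | yes _ | pos .x | here refl = here refl
... | yes x∈b | neg .x | here refl = ⊥-elim (isA (neg x) z∈b x∈b)
... | no x∉b | pos .x | here refl = ⊥-elim (x∉b z∈b)
... | no _ | neg .x | here refl = here refl
... | yes _ | _ | there var∈′ = there (⊆-restrict b xs isA z∈b var∈′)
... | no _ | _ | there var∈′ = there (⊆-restrict b xs isA z∈b var∈′)

choice-representative : ∀ F {b} → IsComplete F b → ∃ λ t → t ∈ choices (variables F) × t ≈ b
choice-representative F {b} (isA , assigns , occurs) =
  restrict b (variables F) , restrict-∈-choices b (variables F) , λ z →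
    mk⇔ (restrict-⊆ b (variables F) (λ x x∈ → assigns x (∈variables⇒occurs F x∈)))
        (λ z∈b → ⊆-restrict b (variables F) isA z∈b (occurs⇒∈variables F (occurs z z∈b)))

-- Tour from a through vertices settled for every choice of literals for the
-- variables of F.  Each assoc b of a clause c is, as a set, one of these
-- choices, and the vertex settled for it is an assoc of c.
corollary2 : (F : Formula) → WellFormed F → Unsatisfiable F →
    (a : Assignment) → IsComplete F a →
    Σ (List Assignment) λ path → IsPathFrom F a path ×
      (∀ c → c ∈ F → HasAssoc F c → ∃ λ b → b ∈ path × IsAssoc F c b)
corollary2 F _ unsat a a-complete with tour F (choices (variables F)) a-complete
... | _ , w , settled-visits =
  vertices F w , (later F w , refl , vertices-complete F w , vertices-linked F w) , visits-assoc
  where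
  visits-assoc : ∀ c → c ∈ F → HasAssoc F c → ∃ λ b → b ∈ vertices F w × IsAssoc F c b
  visits-assoc c _ (b , b-assoc) =
    let t , t∈choices , t≈b = choice-representative F (proj₁ b-assoc)
        y , y∈w , y-settled = All.lookup settled-visits t∈choices
        y-complete = All.lookup (vertices-complete F w) y∈w
    in y , y∈w , settled-assoc unsat b-assoc t≈b y-complete y-settled
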